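{- Let $2\le k<g$ be integers. If there are two distinct even pivot nodes in $Y(g,k)$ that both directly precede the same node, then $Y(g,k)$ is a complete Young graph.
   Context: For integers $2\le k<g$, the labeled directed graph $H(g,k)$ has a distinguished starting node $[[0,0]]$ and other nodes labeled by pairs $[R,r]$ of integers with $0\le R,r\le k-1$ (the node $[0,0]$ is distinct from the starting node). For a node $[P,p]$ (the starting node treated as $[0,0]$ here) there is an edge labeled $(A,a)$ from $[P,p]$ to $[R,r]$ whenever $0\le A,a\le g-1$ are integers, $0\le R,r\le k-1$, $ka+p=A+rg$ and $kA+R=a+Pg$; edges leaving the starting node additionally require $A\ne0\ne a$; no edge enters the starting node. $H(g,k)$ consists of the starting node and all nodes reachable from it. An even pivot node is a node $[a,a]$; an odd pivot node is a node $[r,s]$ with an edge to $[s,r]$; the starting node is not a pivot node. $Y(g,k)$ is obtained from $H(g,k)$ by deleting every node that is not a pivot node and from which no pivot node is reachable, with incident edges. $Y(g,k)$ is a complete Young graph (on $m$ nodes) if its nodes other than the starting node are $m$ nodes forming the complete directed graph on them (an edge from each to each, including self-loops) and there is an edge from the starting node to every node except $[0,0]$. -}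

module Defs where

open import Data.Nat using (ℕ; _+_; _*_; _<_)
open import Data.Product using (Σ; _×_; ∃; _,_)
open import Data.Sum using (_⊎_)
open import Data.Empty using (⊥)
open import Data.Unit using (⊤)
open import Relation.Binary.PropositionalEquality using (_≡_; _≢_)
open import Relation.Binary.Construct.Closure.ReflexiveTransitive using (Star)

-- Nodes: the distinguished starting node [[0,0]], and pair nodes [R,r].
-- (The bounds R,r ≤ k-1 are imposed by the edge relation; since every node
-- of H(g,k) other than the start is the target of an edge, they hold there.)
data Node : Set where
  start : Node
  nd    : ℕ → ℕ → Node

fstN : Node → ℕ
fstN start    = 0
fstN (nd P p) = P

sndN : Node → ℕ
sndN start    = 0
sndN (nd P p) = p

StartCond : Node → ℕ → ℕ → Set
StartCond start    A a = (A ≢ 0) × (a ≢ 0)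
StartCond (nd _ _) A a = ⊤

record LabelledEdge (g k : ℕ) (u : Node) (R r A a : ℕ) : Set where
  field
    A<g  : A < g
    a<g  : a < g
    R<k  : R < k
    r<k  : r < k
    eq₁  : k * a + sndN u ≡ A + r * g
    eq₂  : k * A + R ≡ a + fstN u * g
    cond : StartCond u A a

data Edge (g k : ℕ) : Node → Node → Set where
  edge : ∀ {u R r} A a → LabelledEdge g k u R r A a → Edge g k u (nd R r)

InH : ℕ → ℕ → Node → Set
InH g k v = Star (Edge g k) start v

EvenPivot : ℕ → ℕ → Node → Set
EvenPivot g k start    = ⊥
EvenPivot g k (nd R r) = R ≡ r

OddPivot : ℕ → ℕ → Node → Set
OddPivot g k start    = ⊥
OddPivot g k (nd r s) = Edge g k (nd r s) (nd s r)

IsPivot : ℕ → ℕ → Node → Set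
IsPivot g k v = InH g k v × (EvenPivot g k v ⊎ OddPivot g k v)

InY : ℕ → ℕ → Node → Set
InY g k v = InH g k v × (IsPivot g k v ⊎ ∃ λ w → Star (Edge g k) v w × IsPivot g k w)

YEdge : ℕ → ℕ → Node → Node → Set
YEdge g k u v = InY g k u × InY g k v × Edge g k u v

CompleteYoung : ℕ → ℕ → Set
CompleteYoung g k =
  InY g k start ×
  (∀ u v → InY g k u → InY g k v → u ≢ start → v ≢ start → YEdge g k u v) ×
  (∀ v → InY g k v → v ≢ start → v ≢ nd 0 0 → YEdge g k start v)

module Submission where

open import Defs
open import Data.Nat using (ℕ; _≤_; _<_)
open import Data.Product using (Σ; _×_)
open import Relation.Binary.PropositionalEquality using (_≢_)
open import Data.Nat using (suc; _+_; _*_; _∸_; _%_; s≤s; z≤n; NonZero; >-nonZero)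
open import Data.Nat.Properties
open import Data.Nat.DivMod using (m<n⇒m%n≡m; [m+kn]%n≡m%n)
open import Data.Nat.Divisibility using (_∣_; divides; _∣0; m∣m*n; ∣m+n∣m⇒∣n)
open import Data.Nat.Tactic.RingSolver using (solve-∀)
open import Data.Product using (_,_; proj₁; ∃)
open import Data.Sum using (_⊎_; inj₁; inj₂)
open import Data.Empty using (⊥-elim)
open import Data.Unit using (tt)
open import Relation.Binary.PropositionalEquality
  using (_≡_; refl; sym; trans; cong; cong₂; subst; module ≡-Reasoning)
open import Relation.Binary.Construct.Closure.ReflexiveTransitive using (Star; ε; _◅_)
open import Relation.Binary.Definitions using (tri<; tri≈; tri>)

-- Write k = j + 1 (so j ≥ 1), g = k + d (so d ≥ 1) and N = k² − 1 = j(j + 2).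
-- Eliminating the label A from the two equations of an edge (A,a) leaving a
-- diagonal node [P,P] (or the start, where P = 0) into [R,r] gives the
-- edge equation  N·a + R = P·d + k·r·g,  in which k·g ≡ 1 + k·d (mod N).
--   * Two edges from distinct diagonal nodes [a,a], [b,b] into a common node
--     subtract to N ∣ (b − a)·d: a "period" D with 0 < D ≤ j and N ∣ D·d.
--   * Given a period, an edge out of [P,P] with N ∣ P·d lands on a node
--     [R,R] with R ≤ j and N ∣ R·d: the edge equation gives D·R ≡ D·r (mod N)
--     with both sides below j² < N, and then, multiplied by k, N ∣ R·d.
--   * Conversely any two such "admissible" diagonal nodes are joined by an
--     edge with explicit labels, and the start reaches every nonzero one.
-- So, with a period, every node of H(g,k) is admissible and admissible nodes
-- are pairwise joined, which makes Y(g,k) a complete Young graph.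

residues-equal : ∀ n .{{_ : NonZero n}} {x y} s t → x < n → y < n →
                 x + s * n ≡ y + t * n → x ≡ y
residues-equal n {x} {y} s t x<n y<n eq = begin
  x               ≡⟨ sym (m<n⇒m%n≡m x<n) ⟩
  x % n           ≡⟨ sym ([m+kn]%n≡m%n x s n) ⟩
  (x + s * n) % n ≡⟨ cong (_% n) eq ⟩
  (y + t * n) % n ≡⟨ [m+kn]%n≡m%n y t n ⟩
  y % n           ≡⟨ m<n⇒m%n≡m y<n ⟩
  y               ∎
  where open ≡-Reasoning

edge-target-bounds : ∀ {g k u R r} → Edge g k u (nd R r) → R < k × r < k
edge-target-bounds (edge _ _ e) = R<k , r<k
  where open LabelledEdge e

reachable-bounds : ∀ {g k u R r} → Star (Edge g k) u (nd R r) →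
                   u ≡ nd R r ⊎ (R < k × r < k)
reachable-bounds ε = inj₁ refl
reachable-bounds (e ◅ es) with reachable-bounds es
... | inj₁ refl   = inj₂ (edge-target-bounds e)
... | inj₂ bounds = inj₂ bounds

in-H-bound : ∀ {g k R r} → InH g k (nd R r) → R < k
in-H-bound h with reachable-bounds h
... | inj₁ ()
... | inj₂ (R<k , _) = R<k

module Young (i d' : ℕ) where

  j k d g N : ℕ
  j = suc i
  k = suc j
  d = suc d'
  g = k + d
  N = j * (2 + j)

  -- Eliminating A from the equations of an edge (A,a) from a node with both
  -- coordinates P into [R,r]: k·(first) + (second), using k² = N + 1.
  eliminate-label : ∀ P R r A a → k * a + P ≡ A + r * g → k * A + R ≡ a + P * g →
                    N * a + R ≡ P * d + k * r * g
  eliminate-label P R r A a e₁ e₂ = +-cancelʳ-≡ (a + k * P) _ _ (begin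
    (N * a + R) + (a + k * P)          ≡⟨ expand-first j a P R ⟩
    k * (k * a + P) + R                ≡⟨ cong (λ z → k * z + R) e₁ ⟩
    k * (A + r * g) + R                ≡⟨ expand-second j d A r R ⟩
    (k * A + R) + k * r * g            ≡⟨ cong (_+ k * r * g) e₂ ⟩
    (a + P * g) + k * r * g            ≡⟨ collect j d a P r ⟩
    (P * d + k * r * g) + (a + k * P)  ∎)
    where
    open ≡-Reasoning
    expand-first : ∀ j a P R →
      (j * (2 + j) * a + R) + (a + suc j * P) ≡ suc j * (suc j * a + P) + R
    expand-first = solve-∀
    expand-second : ∀ j d A r R →
      suc j * (A + r * (suc j + d)) + R ≡ (suc j * A + R) + suc j * r * (suc j + d)
    expand-second = solve-∀
    collect : ∀ j d a P r →
      (a + P * (suc j + d)) + suc j * r * (suc j + d)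
        ≡ (P * d + suc j * r * (suc j + d)) + (a + suc j * P)
    collect = solve-∀

  edge-equation : ∀ {u R r A a} → LabelledEdge g k u R r A a → sndN u ≡ fstN u →
                  N * a + R ≡ fstN u * d + k * r * g
  edge-equation {u} {R} {r} {A} {a} e same =
    eliminate-label (fstN u) R r A a (subst (λ z → k * a + z ≡ A + r * g) same eq₁) eq₂
    where open LabelledEdge e

  record Period : Set where
    constructor period
    field
      D         : ℕ
      positive  : 0 < D
      bounded   : D ≤ j
      divisible : N ∣ D * d

  -- Edges from [a,a] and [b,b], a < b ≤ j, into a common target [R,r] yield
  -- the period b − a: their edge equations differ by (b − a)·d = N·(a₂ − a₁).
  common-target-period : ∀ {a b R r A₁ a₁ A₂ a₂} → a < b → b ≤ j →
                         LabelledEdge g k (nd a a) R r A₁ a₁ →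
                         LabelledEdge g k (nd b b) R r A₂ a₂ → Period
  common-target-period {a} {b} {R} {r} {_} {a₁} {_} {a₂} a<b b≤j e₁ e₂ =
    period (b ∸ a) (m<n⇒0<n∸m a<b) (≤-trans (m∸n≤m b a) b≤j)
           (∣m+n∣m⇒∣n (divides a₂ difference) (m∣m*n a₁))
    where
    open ≡-Reasoning
    c : ℕ
    c = k * r * g
    difference : N * a₁ + (b ∸ a) * d ≡ a₂ * N
    difference = +-cancelʳ-≡ R _ _ (begin
      N * a₁ + (b ∸ a) * d + R   ≡⟨ cong (_+ R) (+-comm (N * a₁) _) ⟩
      (b ∸ a) * d + N * a₁ + R   ≡⟨ +-assoc ((b ∸ a) * d) (N * a₁) R ⟩
      (b ∸ a) * d + (N * a₁ + R) ≡⟨ cong ((b ∸ a) * d +_) (edge-equation e₁ refl) ⟩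
      (b ∸ a) * d + (a * d + c)  ≡⟨ sym (+-assoc ((b ∸ a) * d) (a * d) c) ⟩
      (b ∸ a) * d + a * d + c    ≡⟨ cong (_+ c) (sym (*-distribʳ-+ d (b ∸ a) a)) ⟩
      (b ∸ a + a) * d + c        ≡⟨ cong (λ z → z * d + c) (m∸n+n≡m (<⇒≤ a<b)) ⟩
      b * d + c                  ≡⟨ sym (edge-equation e₂ refl) ⟩
      N * a₂ + R                 ≡⟨ cong (_+ R) (*-comm N a₂) ⟩
      a₂ * N + R                 ∎)

  CommonSuccessor : Set
  CommonSuccessor = Σ ℕ λ a → Σ ℕ λ b → Σ Node λ v →
    a ≢ b × YEdge g k (nd a a) v × YEdge g k (nd b b) v

  hypothesis-period : CommonSuccessor → Period
  hypothesis-period (a , b , _ , a≢b , (Ya , _ , edge _ _ e₁) , (Yb , _ , edge _ _ e₂))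
    with <-cmp a b
  ... | tri< a<b _ _ = common-target-period a<b (≤-pred (in-H-bound (proj₁ Yb))) e₁ e₂
  ... | tri≈ _ a≡b _ = ⊥-elim (a≢b a≡b)
  ... | tri> _ _ b<a = common-target-period b<a (≤-pred (in-H-bound (proj₁ Ya))) e₂ e₁

  -- Given a period D and N ∣ P·d, the target [R,r] of an edge out of [P,P]
  -- is diagonal: D·R ≡ D·r (mod N), both sides below j·j < N.
  diagonal-target : ∀ D P R r a → 0 < D → D ≤ j → N ∣ D * d → N ∣ P * d →
                    R ≤ j → r ≤ j → N * a + R ≡ P * d + k * r * g → R ≡ r
  diagonal-target D P R r a 0<D D≤j (divides t Dd) (divides p Pd) R≤j r≤j e =
    *-cancelˡ-≡ R r D {{>-nonZero 0<D}}
      (residues-equal N (D * a) (D * p + D * r + k * r * t)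
                      (below-N R≤j) (below-N r≤j) congruence)
    where
    open ≡-Reasoning
    below-N : ∀ {x} → x ≤ j → D * x < N
    below-N x≤j = ≤-<-trans (*-mono-≤ D≤j x≤j) (*-monoʳ-< j (s≤s (n≤1+n j)))
    scale : ∀ j D R a → D * R + (D * a) * (j * (2 + j)) ≡ D * ((j * (2 + j)) * a + R)
    scale = solve-∀
    expand : ∀ j d D P r → D * (P * d + suc j * r * (suc j + d))
      ≡ D * r + D * r * (j * (2 + j)) + D * (P * d) + suc j * r * (D * d)
    expand = solve-∀
    collect : ∀ j D r p t →
      D * r + D * r * (j * (2 + j)) + D * (p * (j * (2 + j))) + suc j * r * (t * (j * (2 + j)))
        ≡ D * r + (D * p + D * r + suc j * r * t) * (j * (2 + j))
    collect = solve-∀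
    congruence : D * R + (D * a) * N ≡ D * r + (D * p + D * r + k * r * t) * N
    congruence = begin
      D * R + (D * a) * N                                 ≡⟨ scale j D R a ⟩
      D * (N * a + R)                                     ≡⟨ cong (D *_) e ⟩
      D * (P * d + k * r * g)                             ≡⟨ expand j d D P r ⟩
      D * r + D * r * N + D * (P * d) + k * r * (D * d)   ≡⟨ cong₂ (λ u v → D * r + D * r * N + D * u + k * r * v) Pd Dd ⟩
      D * r + D * r * N + D * (p * N) + k * r * (t * N)   ≡⟨ collect j D r p t ⟩
      D * r + (D * p + D * r + k * r * t) * N             ∎

  -- The diagonal target [R,R] inherits divisibility: k times the edge
  -- equation reads N·(k·a) = N·(k·p + k·R + R·d) + R·d, using k² = N + 1.
  divisible-target : ∀ P R a → N ∣ P * d → N * a + R ≡ P * d + k * R * g → N ∣ R * d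
  divisible-target P R a (divides p Pd) e =
    ∣m+n∣m⇒∣n (divides (k * a) multiple) (m∣m*n (k * p + k * R + R * d))
    where
    open ≡-Reasoning
    expand : ∀ j d p R → (j * (2 + j)) * (suc j * p + suc j * R + R * d) + R * d + suc j * R
      ≡ suc j * (p * (j * (2 + j)) + suc j * R * (suc j + d))
    expand = solve-∀
    scale : ∀ j a R → suc j * ((j * (2 + j)) * a + R) ≡ suc j * a * (j * (2 + j)) + suc j * R
    scale = solve-∀
    multiple : N * (k * p + k * R + R * d) + R * d ≡ k * a * N
    multiple = +-cancelʳ-≡ (k * R) _ _ (begin
      N * (k * p + k * R + R * d) + R * d + k * R ≡⟨ expand j d p R ⟩
      k * (p * N + k * R * g)                     ≡⟨ cong (λ z → k * (z + k * R * g)) (sym Pd) ⟩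
      k * (P * d + k * R * g)                     ≡⟨ cong (k *_) (sym e) ⟩
      k * (N * a + R)                             ≡⟨ scale j a R ⟩
      k * a * N + k * R                           ∎)

  data Admissible : Node → Set where
    at-start : Admissible start
    diagonal : ∀ {x} → x ≤ j → N ∣ x * d → Admissible (nd x x)

  admissible-target : Period → ∀ {u R r A a} → LabelledEdge g k u R r A a →
                      sndN u ≡ fstN u → N ∣ fstN u * d → Admissible (nd R r)
  admissible-target (period D 0<D D≤j Dd) {u} {R} {r} {_} {a} e same Pd
    with s≤s R≤j ← LabelledEdge.R<k e | s≤s r≤j ← LabelledEdge.r<k e
    with refl ← diagonal-target D (fstN u) R r a 0<D D≤j Dd Pd R≤j r≤j (edge-equation e same)
    = diagonal R≤j (divisible-target (fstN u) R a Pd (edge-equation e same))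

  admissible-step : Period → ∀ {u v} → Admissible u → Edge g k u v → Admissible v
  admissible-step p at-start       (edge _ _ e) = admissible-target p e refl (N ∣0)
  admissible-step p (diagonal _ Pd) (edge _ _ e) = admissible-target p e refl Pd

  reachable-admissible : Period → ∀ {u v} → Admissible u → Star (Edge g k) u v → Admissible v
  reachable-admissible p adm ε        = adm
  reachable-admissible p adm (e ◅ es) = reachable-admissible p (admissible-step p adm e) es

  -- The label a of the edge [x,x] → [y,y] when x·d = qx·N and y·d = qy·N;
  -- the label A is  label x qy qx.
  label : ℕ → ℕ → ℕ → ℕ
  label y qx qy = qx + y + k * qy

  label-equation : ∀ x y qx qy → y * d ≡ qy * N →
                   k * label y qx qy + x ≡ label x qy qx + y * g
  label-equation x y qx qy yd = sym (begin
    label x qy qx + y * g               ≡⟨ expand j d x y qx qy ⟩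
    qy + x + k * qx + y * k + y * d     ≡⟨ cong (qy + x + k * qx + y * k +_) yd ⟩
    qy + x + k * qx + y * k + qy * N    ≡⟨ collect j x y qx qy ⟩
    k * label y qx qy + x               ∎)
    where
    open ≡-Reasoning
    expand : ∀ j d x y qx qy → (qy + x + suc j * qx) + y * (suc j + d)
      ≡ qy + x + suc j * qx + y * suc j + y * d
    expand = solve-∀
    collect : ∀ j x y qx qy → qy + x + suc j * qx + y * suc j + qy * (j * (2 + j))
      ≡ suc j * (qx + y + suc j * qy) + x
    collect = solve-∀

  -- The labels are below g: N·label ≤ j·d + N·j + k·j·d = N·(j + d) < N·g.
  label-bound : ∀ x y qx qy → x * d ≡ qx * N → y * d ≡ qy * N → x ≤ j → y ≤ j →
                label y qx qy < g
  label-bound x y qx qy xd yd x≤j y≤j = *-cancelˡ-< N _ _ (begin-strict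
    N * label y qx qy                ≡⟨ expand j qx y qy ⟩
    qx * N + N * y + k * (qy * N)    ≡⟨ cong₂ (λ u v → u + N * y + k * v) (sym xd) (sym yd) ⟩
    x * d + N * y + k * (y * d)      ≤⟨ +-mono-≤ (+-mono-≤ (*-monoˡ-≤ d x≤j) (*-monoʳ-≤ N y≤j))
                                                 (*-monoʳ-≤ k (*-monoˡ-≤ d y≤j)) ⟩
    j * d + N * j + k * (j * d)      ≡⟨ collect j d ⟩
    N * (j + d)                      <⟨ *-monoʳ-< N (n<1+n (j + d)) ⟩
    N * g                            ∎)
    where
    open ≤-Reasoning
    expand : ∀ j qx y qy → (j * (2 + j)) * (qx + y + suc j * qy)
      ≡ qx * (j * (2 + j)) + (j * (2 + j)) * y + suc j * (qy * (j * (2 + j)))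
    expand = solve-∀
    collect : ∀ j d → j * d + (j * (2 + j)) * j + suc j * (j * d) ≡ (j * (2 + j)) * (j + d)
    collect = solve-∀

  diagonal-edge : ∀ {x y} → x ≤ j → y ≤ j → N ∣ x * d → N ∣ y * d → Edge g k (nd x x) (nd y y)
  diagonal-edge {x} {y} x≤j y≤j (divides qx xd) (divides qy yd) =
    edge (label x qy qx) (label y qx qy) record
      { A<g  = label-bound y x qy qx yd xd y≤j x≤j
      ; a<g  = label-bound x y qx qy xd yd x≤j y≤j
      ; R<k  = s≤s y≤j
      ; r<k  = s≤s y≤j
      ; eq₁  = label-equation x y qx qy yd
      ; eq₂  = label-equation y x qy qx xd
      ; cond = tt
      }

  -- The start (treated as [0,0]) has an edge to every admissible [y,y] with
  -- y ≠ 0; both labels are nonzero because y ≠ 0 forces y·d ≠ 0.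
  start-edge : ∀ {y} → y ≤ j → N ∣ y * d → y ≢ 0 → Edge g k start (nd y y)
  start-edge {y} y≤j (divides qy yd) y≢0 =
    edge (label 0 qy 0) (label y 0 qy) record
      { A<g  = label-bound y 0 qy 0 yd refl y≤j z≤n
      ; a<g  = label-bound 0 y 0 qy refl yd z≤n y≤j
      ; R<k  = s≤s y≤j
      ; r<k  = s≤s y≤j
      ; eq₁  = label-equation 0 y 0 qy yd
      ; eq₂  = label-equation y 0 qy 0 refl
      ; cond = A≢0 , a≢0
      }
    where
    a≢0 : label y 0 qy ≢ 0
    a≢0 eq = y≢0 (m+n≡0⇒m≡0 y eq)
    A≢0 : label 0 qy 0 ≢ 0
    A≢0 eq = y≢0 (m*n≡0⇒m≡0 y d (trans yd (cong (_* N) (m+n≡0⇒m≡0 qy (m+n≡0⇒m≡0 (qy + 0) eq)))))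

  admissible-edge : ∀ {u v} → Admissible u → Admissible v → u ≢ start → v ≢ start → Edge g k u v
  admissible-edge at-start _ u≢start _ = ⊥-elim (u≢start refl)
  admissible-edge _ at-start _ v≢start = ⊥-elim (v≢start refl)
  admissible-edge (diagonal x≤j xd) (diagonal y≤j yd) _ _ = diagonal-edge x≤j y≤j xd yd

  admissible-start-edge : ∀ {v} → Admissible v → v ≢ start → v ≢ nd 0 0 → Edge g k start v
  admissible-start-edge at-start v≢start _ = ⊥-elim (v≢start refl)
  admissible-start-edge (diagonal y≤j yd) _ v≢00 =
    start-edge y≤j yd (λ { refl → v≢00 refl })

  complete-young : Period → InY g k start → CompleteYoung g k
  complete-young p Ystart =
      Ystart
    , (λ u v Yu Yv u≢start v≢start →
         Yu , Yv , admissible-edge (admissible Yu) (admissible Yv) u≢start v≢start)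
    , (λ v Yv v≢start v≢00 →
         Ystart , Yv , admissible-start-edge (admissible Yv) v≢start v≢00)
    where
    admissible : ∀ {v} → InY g k v → Admissible v
    admissible Yv = reachable-admissible p at-start (proj₁ Yv)

  hypothesis-start : CommonSuccessor → InY g k start
  hypothesis-start (a , _ , _ , _ , (Ya , _) , _) =
    ε , inj₂ (nd a a , proj₁ Ya , proj₁ Ya , inj₁ refl)

positive-excess : ∀ {k g} → k < g → ∃ λ d' → g ≡ k + suc d'
positive-excess {k} k<g with m≤n⇒∃[o]m+o≡n k<g
... | d' , refl = d' , sym (+-suc k d')

proposition2 : (g k : ℕ) → 2 ≤ k → k < g →
    (Σ ℕ λ a → Σ ℕ λ b → Σ Node λ v →
    a ≢ b × YEdge g k (nd a a) v × YEdge g k (nd b b) v) →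
    CompleteYoung g k
proposition2 g (suc (suc i)) (s≤s (s≤s z≤n)) k<g hyp with positive-excess k<g
... | d' , refl = complete-young (hypothesis-period hyp) (hypothesis-start hyp)
  where open Young i d'
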